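{- Let $X_1,X_2$ be finite posets and let a finite group $G$ act by poset automorphisms on the join $X_1\ast X_2$. Then $G$ preserves $X_1$ and $X_2$, and $$\mathrm{Ehr}_{\rho^*}(\mathscr{O}(X_1\ast X_2);t)=(1-t)\,\mathrm{Ehr}_{\rho_1^*}(\mathscr{O}(X_1);t)\,\mathrm{Ehr}_{\rho_2^*}(\mathscr{O}(X_2);t),$$ where $\rho^*,\rho_1^*,\rho_2^*$ are the permutation representations of $G$ on $\mathbb{R}^{X_1\ast X_2}$, $\mathbb{R}^{X_1}$, $\mathbb{R}^{X_2}$ given by $f\mapsto f\circ g^{ -1}$.
   Context: The join $X_1\ast X_2$ is the poset on the disjoint union $X_1\sqcup X_2$ in which $x\le y$ iff $x,y\in X_1$ and $x\le_{X_1}y$, or $x,y\in X_2$ and $x\le_{X_2}y$, or $x\in X_1$, $y\in X_2$. The order polytope of a finite poset $X$ is $\mathscr{O}(X)=\{f\in\mathbb{R}^X:0\le f(x)\le f(x')\le1\text{ for } x\le x'\}$. Equivariant Ehrhart series: $\mathrm{Ehr}(P;t)=1+\sum_{m\ge1}\chi_{mP}t^m\in R_G[[t]]$ where $\chi_{mP}$ is the character of the complex permutation representation of $G$ on $mP\cap\mathbb{Z}^X$ and $R_G$ is the ring of virtual characters of $G$. -}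

module Defs where

open import Data.Bool using (Bool; true; false; T; not; _∨_; if_then_else_)
open import Data.Nat as ℕ using (ℕ; zero; suc; _≤ᵇ_; _≡ᵇ_)
open import Data.Fin using (Fin; zero; suc; toℕ; splitAt)
open import Data.Sum using (_⊎_; inj₁; inj₂)
open import Data.List using (List; []; _∷_; map; concatMap; allFin; upTo; foldr)
open import Data.Bool.ListAction using (all)
open import Data.Nat.ListAction using (sum)
open import Data.Integer as ℤ using (ℤ; +_)
open import Relation.Binary.PropositionalEquality using (_≡_)

record FinPoset : Set where
  field
    size    : ℕ
    leq     : Fin size → Fin size → Bool
    refl    : ∀ x → T (leq x x)
    antisym : ∀ x y → T (leq x y) → T (leq y x) → x ≡ y
    trans   : ∀ x y z → T (leq x y) → T (leq y z) → T (leq x z)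
open FinPoset public

-- The order of the join X₁ * X₂ on Fin (n₁ + n₂): the first n₁ elements are X₁,
-- the last n₂ are X₂, and every element of X₁ lies below every element of X₂.
joinLeq : (X₁ X₂ : FinPoset) → Fin (size X₁ ℕ.+ size X₂) → Fin (size X₁ ℕ.+ size X₂) → Bool
joinLeq X₁ X₂ x y with splitAt (size X₁) x | splitAt (size X₁) y
... | inj₁ a | inj₁ b = leq X₁ a b
... | inj₂ a | inj₂ b = leq X₂ a b
... | inj₁ a | inj₂ b = true
... | inj₂ a | inj₁ b = false

allFuns : (n k : ℕ) → List (Fin n → Fin k)
allFuns zero k = (λ ()) ∷ []
allFuns (suc n) k =
  concatMap (λ f → map (λ a → λ { zero → a ; (suc i) → f i }) (allFin k)) (allFuns n k)

allB : (n : ℕ) → (Fin n → Bool) → Bool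
allB n p = all p (allFin n)

-- f : X → {0,…,m} is order preserving (i.e. f ∈ m·𝒪(X) ∩ ℤ^X, via Fin (suc m) ≅ {0..m})
isOrderPreserving : (n : ℕ) (leq' : Fin n → Fin n → Bool) {k : ℕ} → (Fin n → Fin k) → Bool
isOrderPreserving n leq' f =
  allB n (λ x → allB n (λ y → not (leq' x y) ∨ (toℕ (f x) ≤ᵇ toℕ (f y))))

-- f is fixed by the permutation action f ↦ f ∘ σ (σ = action of g⁻¹)
isFixedBy : (n : ℕ) (σ : Fin n → Fin n) {k : ℕ} → (Fin n → Fin k) → Bool
isFixedBy n σ f = allB n (λ x → toℕ (f (σ x)) ≡ᵇ toℕ (f x))

-- Character value at g of the permutation representation on m𝒪(X) ∩ ℤ^X:
-- the number of lattice points fixed by g, where σ is the action of g⁻¹ on X.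
fixedLatticePoints : (n : ℕ) (leq' : Fin n → Fin n → Bool) (σ : Fin n → Fin n) (m : ℕ) → ℕ
fixedLatticePoints n leq' σ m =
  sum (map (λ f → if isOrderPreserving n leq' f then (if isFixedBy n σ f then 1 else 0) else 0)
                     (allFuns n (suc m)))

-- Coefficients of the equivariant Ehrhart series, evaluated at a fixed group element
-- (σ = action of g⁻¹): coefficient 0 is the trivial character 1.
ehrCoeff : (n : ℕ) (leq' : Fin n → Fin n → Bool) (σ : Fin n → Fin n) → ℕ → ℤ
ehrCoeff n leq' σ zero = + 1
ehrCoeff n leq' σ (suc m) = + fixedLatticePoints n leq' σ (suc m)

Series : Set
Series = ℕ → ℤ

_⊛_ : Series → Series → Series
(a ⊛ b) m = foldr ℤ._+_ (+ 0) (map (λ i → a i ℤ.* b (m ℕ.∸ i)) (upTo (suc m)))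

oneMinusT : Series → Series
oneMinusT s zero = s zero
oneMinusT s (suc m) = s (suc m) ℤ.- s m

module Submission where

-- A lattice point of m𝒪(X₁ * X₂) is a pair of order-preserving labellings v₁ : X₁ → [0, m] and
-- v₂ : X₂ → [0, m] with max v₁ ≤ min v₂, and since g preserves X₁ and X₂ it is g-fixed iff both
-- halves are.  Counting the g-fixed pairs together with a level k such that max v₁ ≤ k ≤ min v₂
-- gives D(m) = Σₖ N₁(k) N₂(m − k), where Nᵢ(k) counts the g-fixed lattice points of k𝒪(Xᵢ)
-- (shift v₂ down by k).  Requiring max v₁ ≤ k < min v₂ instead gives D(m − 1); the two counts
-- differ by exactly one for each separated pair, so the number of g-fixed lattice points of
-- m𝒪(X₁ * X₂) is D(m) − D(m − 1), the coefficient of tᵐ in (1 − t) Ehr₁ Ehr₂.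
--
-- That g preserves X₁ is a pigeonhole argument: if g sent some x ∈ X₁ into X₂, it would map the
-- n₂ + 1 elements of {x} ∪ X₂, all of which lie above x, injectively into X₂.

open import Defs hiding (refl; trans)
open import Level using (Level)
open import Algebra.Bundles using (Group)
open import Data.Bool using (Bool; true; false; T; not; _∧_; _∨_; if_then_else_)
open import Data.Bool.Properties using (T-∧; ∧-identityʳ)
open import Data.Bool.ListAction using (and)
open import Data.Nat using (ℕ; zero; suc; _+_; _*_; _∸_; _⊔_; _⊓_; _≤_; _<_; z≤n; s≤s; s≤s⁻¹; _≤ᵇ_; _≡ᵇ_)
open import Data.Nat.Properties
open import Data.Nat.ListAction using (sum)
open import Data.Nat.ListAction.Properties using (sum-++)
open import Data.Fin using (Fin; zero; suc; toℕ; splitAt; _↑ˡ_; _↑ʳ_)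
open import Data.Fin.Properties
  using (toℕ<n; ↑ʳ-injective; <⇒notInjective; splitAt-↑ˡ; splitAt-↑ʳ; splitAt⁻¹-↑ˡ; splitAt⁻¹-↑ʳ)
open import Data.List using (List; []; _∷_; _++_; map; concatMap; allFin; tabulate; foldr; applyUpTo)
open import Data.List.Properties using (map-cong; map-∘; map-++)
open import Data.List.Membership.Propositional.Properties using (∈-allFin)
import Data.List.Relation.Unary.All as All
open import Data.List.Relation.Unary.All.Properties using (all⁺; all⁻)
open import Data.Vec.Functional using () renaming (_∷_ to _∷ᵥ_; _++_ to _++ᵥ_)
open import Data.Vec.Functional.Properties using (++-cong; lookup-++ˡ; lookup-++ʳ)
open import Data.Integer as ℤ using (ℤ)
import Data.Integer.Properties as ℤ
open import Data.Unit using (tt)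
open import Data.Empty using (⊥-elim)
open import Data.Sum using (_⊎_; inj₁; inj₂)
open import Data.Product using (Σ; ∃; _×_; _,_; proj₁; proj₂)
open import Function using (_∘_; _⇔_; mk⇔; Equivalence; case_of_)
open import Relation.Binary.Core using (_Preserves_⟶_)
open import Function.Definitions using (Injective)
open import Relation.Binary.PropositionalEquality
open import Data.Nat.Tactic.RingSolver using (solve-∀)
open import Algebra.Properties.CommutativeSemigroup +-commutativeSemigroup
  using () renaming (interchange to +-interchange)
open import Algebra.Properties.CommutativeSemigroup *-commutativeSemigroup
  using () renaming (interchange to *-interchange)

sumBy : {A : Set} → List A → (A → ℕ) → ℕ
sumBy xs F = sum (map F xs)

module _ {A : Set} where

  sumBy-cong : (xs : List A) {F G : A → ℕ} → F ≗ G → sumBy xs F ≡ sumBy xs G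
  sumBy-cong xs F≗G = cong sum (map-cong F≗G xs)

  sumBy-const-0 : (xs : List A) → sumBy xs (λ _ → 0) ≡ 0
  sumBy-const-0 []       = refl
  sumBy-const-0 (x ∷ xs) = sumBy-const-0 xs

  sumBy-distrib-+ : (xs : List A) (F G : A → ℕ) → sumBy xs (λ x → F x + G x) ≡ sumBy xs F + sumBy xs G
  sumBy-distrib-+ []       F G = refl
  sumBy-distrib-+ (x ∷ xs) F G = begin
    F x + G x + sumBy xs (λ x → F x + G x)   ≡⟨ cong (F x + G x +_) (sumBy-distrib-+ xs F G) ⟩
    F x + G x + (sumBy xs F + sumBy xs G)    ≡⟨ +-interchange (F x) (G x) (sumBy xs F) (sumBy xs G) ⟩
    F x + sumBy xs F + (G x + sumBy xs G)    ∎
    where open ≡-Reasoning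

  *-distribˡ-sumBy : (c : ℕ) (xs : List A) (F : A → ℕ) → c * sumBy xs F ≡ sumBy xs (λ x → c * F x)
  *-distribˡ-sumBy c []       F = *-zeroʳ c
  *-distribˡ-sumBy c (x ∷ xs) F =
    trans (*-distribˡ-+ c (F x) (sumBy xs F)) (cong (c * F x +_) (*-distribˡ-sumBy c xs F))

  *-distribʳ-sumBy : (c : ℕ) (xs : List A) (F : A → ℕ) → sumBy xs F * c ≡ sumBy xs (λ x → F x * c)
  *-distribʳ-sumBy c []       F = refl
  *-distribʳ-sumBy c (x ∷ xs) F =
    trans (*-distribʳ-+ c (F x) (sumBy xs F)) (cong (F x * c +_) (*-distribʳ-sumBy c xs F))

  sumBy-++ : (xs ys : List A) (F : A → ℕ) → sumBy (xs ++ ys) F ≡ sumBy xs F + sumBy ys F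
  sumBy-++ xs ys F = trans (cong sum (map-++ F xs ys)) (sum-++ (map F xs) (map F ys))

  sumBy-map : {B : Set} (g : B → A) (xs : List B) (F : A → ℕ) → sumBy (map g xs) F ≡ sumBy xs (F ∘ g)
  sumBy-map g xs F = cong sum (sym (map-∘ xs))

  sumBy-concatMap : {B : Set} (h : B → List A) (xs : List B) (F : A → ℕ) →
    sumBy (concatMap h xs) F ≡ sumBy xs (λ x → sumBy (h x) F)
  sumBy-concatMap h []       F = refl
  sumBy-concatMap h (x ∷ xs) F =
    trans (sumBy-++ (h x) (concatMap h xs) F) (cong (sumBy (h x) F +_) (sumBy-concatMap h xs F))

sumUpTo : ℕ → (ℕ → ℕ) → ℕ
sumUpTo zero    h = 0
sumUpTo (suc n) h = h 0 + sumUpTo n (h ∘ suc)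

sumUpTo-cong : ∀ n {h h′ : ℕ → ℕ} → (∀ k → k < n → h k ≡ h′ k) → sumUpTo n h ≡ sumUpTo n h′
sumUpTo-cong zero    eq = refl
sumUpTo-cong (suc n) eq = cong₂ _+_ (eq 0 (s≤s z≤n)) (sumUpTo-cong n (λ k k<n → eq (suc k) (s≤s k<n)))

sumUpTo-const-0 : ∀ n → sumUpTo n (λ _ → 0) ≡ 0
sumUpTo-const-0 zero    = refl
sumUpTo-const-0 (suc n) = sumUpTo-const-0 n

*-distribˡ-sumUpTo : ∀ c n (h : ℕ → ℕ) → c * sumUpTo n h ≡ sumUpTo n (λ k → c * h k)
*-distribˡ-sumUpTo c zero    h = *-zeroʳ c
*-distribˡ-sumUpTo c (suc n) h =
  trans (*-distribˡ-+ c (h 0) _) (cong (c * h 0 +_) (*-distribˡ-sumUpTo c n (h ∘ suc)))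

*-distribʳ-sumUpTo : ∀ c n (h : ℕ → ℕ) → sumUpTo n h * c ≡ sumUpTo n (λ k → h k * c)
*-distribʳ-sumUpTo c zero    h = refl
*-distribʳ-sumUpTo c (suc n) h =
  trans (*-distribʳ-+ c (h 0) _) (cong (h 0 * c +_) (*-distribʳ-sumUpTo c n (h ∘ suc)))

sumUpTo-sumBy : ∀ {A : Set} n (xs : List A) (F : ℕ → A → ℕ) →
  sumUpTo n (λ k → sumBy xs (F k)) ≡ sumBy xs (λ x → sumUpTo n (λ k → F k x))
sumUpTo-sumBy zero    xs F = sym (sumBy-const-0 xs)
sumUpTo-sumBy (suc n) xs F =
  trans (cong (sumBy xs (F 0) +_) (sumUpTo-sumBy n xs (F ∘ suc))) (sym (sumBy-distrib-+ xs (F 0) _))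

sumBy-tabulate : ∀ {A : Set} n (f : Fin n → A) (F : A → ℕ) (h : ℕ → ℕ) →
  (∀ i → F (f i) ≡ h (toℕ i)) → sumBy (tabulate f) F ≡ sumUpTo n h
sumBy-tabulate zero    f F h eq = refl
sumBy-tabulate (suc n) f F h eq = cong₂ _+_ (eq zero) (sumBy-tabulate n (f ∘ suc) F (h ∘ suc) (eq ∘ suc))

𝟙 : Bool → ℕ
𝟙 b = if b then 1 else 0

𝟙-∧ : ∀ a b → 𝟙 (a ∧ b) ≡ 𝟙 a * 𝟙 b
𝟙-∧ false b     = refl
𝟙-∧ true  false = refl
𝟙-∧ true  true  = refl

≤ᵇ-suc : ∀ a b → (suc a ≤ᵇ suc b) ≡ (a ≤ᵇ b)
≤ᵇ-suc zero    b = refl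
≤ᵇ-suc (suc a) b = refl

𝟙*-cong : ∀ b {x y} → (T b → x ≡ y) → 𝟙 b * x ≡ 𝟙 b * y
𝟙*-cong false eq = refl
𝟙*-cong true  eq = cong (_+ 0) (eq tt)

inWindow : ℕ → ℕ → ℕ → Bool
inWindow k w a = (k ≤ᵇ a) ∧ (a ≤ᵇ k + w)

sumUpTo-initial : ∀ m w → w ≤ m → (h : ℕ → ℕ) →
  sumUpTo (suc m) (λ a → 𝟙 (a ≤ᵇ w) * h a) ≡ sumUpTo (suc w) h
sumUpTo-initial m       zero    w≤m       h = cong₂ _+_ (+-identityʳ (h 0)) (sumUpTo-const-0 m)
sumUpTo-initial (suc m) (suc w) (s≤s w≤m) h = cong₂ _+_ (+-identityʳ (h 0)) (begin
  sumUpTo (suc m) (λ a → 𝟙 (suc a ≤ᵇ suc w) * h (suc a))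
    ≡⟨ sumUpTo-cong (suc m) (λ a _ → cong (λ b → 𝟙 b * h (suc a)) (≤ᵇ-suc a w)) ⟩
  sumUpTo (suc m) (λ a → 𝟙 (a ≤ᵇ w) * h (suc a))
    ≡⟨ sumUpTo-initial m w w≤m (h ∘ suc) ⟩
  sumUpTo (suc w) (h ∘ suc) ∎)
  where open ≡-Reasoning

sumUpTo-window : ∀ m k w → k + w ≤ m → (h : ℕ → ℕ) →
  sumUpTo (suc m) (λ a → 𝟙 (inWindow k w a) * h (a ∸ k)) ≡ sumUpTo (suc w) h
sumUpTo-window m       zero    w k+w≤m       h = sumUpTo-initial m w k+w≤m h
sumUpTo-window (suc m) (suc k) w (s≤s k+w≤m) h = begin
  sumUpTo (suc m) (λ a → 𝟙 ((suc k ≤ᵇ suc a) ∧ (suc a ≤ᵇ suc k + w)) * h (a ∸ k))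
    ≡⟨ sumUpTo-cong (suc m) (λ a _ → cong₂ (λ b c → 𝟙 (b ∧ c) * h (a ∸ k)) (≤ᵇ-suc k a) (≤ᵇ-suc a (k + w))) ⟩
  sumUpTo (suc m) (λ a → 𝟙 (inWindow k w a) * h (a ∸ k))
    ≡⟨ sumUpTo-window m k w k+w≤m h ⟩
  sumUpTo (suc w) h ∎
  where open ≡-Reasoning

interval-telescope : ∀ m M₁ M₂ → M₁ ≤ m → M₂ ≤ m →
  𝟙 (M₁ ≤ᵇ M₂) + sumUpTo m (λ k → 𝟙 (M₁ ≤ᵇ k) * 𝟙 (suc k ≤ᵇ M₂))
    ≡ sumUpTo (suc m) (λ k → 𝟙 (M₁ ≤ᵇ k) * 𝟙 (k ≤ᵇ M₂))
interval-telescope zero    zero     zero     _          _          = refl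
interval-telescope (suc m) zero     zero     _          _          =
  cong suc (trans (sumUpTo-const-0 m) (sym (sumUpTo-const-0 (suc m))))
interval-telescope (suc m) zero     (suc M₂) _          (s≤s M₂≤m) = cong suc (begin
  suc (sumUpTo m (λ k → 𝟙 (suc (suc k) ≤ᵇ suc M₂) + 0))
    ≡⟨ cong suc (sumUpTo-cong m (λ k _ → cong (λ b → 𝟙 b + 0) (≤ᵇ-suc (suc k) M₂))) ⟩
  suc (sumUpTo m (λ k → 𝟙 (suc k ≤ᵇ M₂) + 0))
    ≡⟨ interval-telescope m zero M₂ z≤n M₂≤m ⟩
  sumUpTo (suc m) (λ k → 𝟙 (k ≤ᵇ M₂) + 0)
    ≡⟨ sumUpTo-cong (suc m) (λ k _ → cong (λ b → 𝟙 b + 0) (≤ᵇ-suc k M₂)) ⟨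
  sumUpTo (suc m) (λ k → 𝟙 (suc k ≤ᵇ suc M₂) + 0) ∎)
  where open ≡-Reasoning
interval-telescope (suc m) (suc M₁) zero     _          _          = trans (vanishes m) (sym (vanishes (suc m)))
  where
  vanishes : ∀ n → sumUpTo n (λ k → 𝟙 (suc M₁ ≤ᵇ suc k) * 0) ≡ 0
  vanishes n = trans (sumUpTo-cong n (λ k _ → *-zeroʳ (𝟙 (suc M₁ ≤ᵇ suc k)))) (sumUpTo-const-0 n)
interval-telescope (suc m) (suc M₁) (suc M₂) (s≤s M₁≤m) (s≤s M₂≤m) = begin
  𝟙 (suc M₁ ≤ᵇ suc M₂) + sumUpTo m (λ k → 𝟙 (suc M₁ ≤ᵇ suc k) * 𝟙 (suc (suc k) ≤ᵇ suc M₂))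
    ≡⟨ cong₂ _+_ (cong 𝟙 (≤ᵇ-suc M₁ M₂))
         (sumUpTo-cong m (λ k _ → cong₂ (λ a b → 𝟙 a * 𝟙 b) (≤ᵇ-suc M₁ k) (≤ᵇ-suc (suc k) M₂))) ⟩
  𝟙 (M₁ ≤ᵇ M₂) + sumUpTo m (λ k → 𝟙 (M₁ ≤ᵇ k) * 𝟙 (suc k ≤ᵇ M₂))
    ≡⟨ interval-telescope m M₁ M₂ M₁≤m M₂≤m ⟩
  sumUpTo (suc m) (λ k → 𝟙 (M₁ ≤ᵇ k) * 𝟙 (k ≤ᵇ M₂))
    ≡⟨ sumUpTo-cong (suc m) (λ k _ → cong₂ (λ a b → 𝟙 a * 𝟙 b) (≤ᵇ-suc M₁ k) (≤ᵇ-suc k M₂)) ⟨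
  sumUpTo (suc m) (λ k → 𝟙 (suc M₁ ≤ᵇ suc k) * 𝟙 (suc k ≤ᵇ suc M₂)) ∎
  where open ≡-Reasoning

T-injective : ∀ {a b} → (T a → T b) → (T b → T a) → a ≡ b
T-injective {false} {false} _ _ = refl
T-injective {false} {true}  _ g = ⊥-elim (g tt)
T-injective {true}  {false} f _ = ⊥-elim (f tt)
T-injective {true}  {true}  _ _ = refl

module _ {n : ℕ} where

  T-allB : (p : Fin n → Bool) → T (allB n p) ⇔ (∀ x → T (p x))
  T-allB p = mk⇔ (λ t x → All.lookup (all⁺ p (allFin n) t) (∈-allFin x))
                 (λ h → all⁻ p {allFin n} (All.tabulate (λ {x} _ → h x)))

  allB-cong : {p q : Fin n → Bool} → p ≗ q → allB n p ≡ allB n q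
  allB-cong p≗q = cong and (map-cong p≗q (allFin n))

  allB-true : allB n (λ _ → true) ≡ true
  allB-true = T-injective _ (λ _ → Equivalence.from (T-allB _) _)

↑-cases : ∀ {n₁ n₂} (x : Fin (n₁ + n₂)) → (∃ λ i → x ≡ i ↑ˡ n₂) ⊎ (∃ λ j → x ≡ n₁ ↑ʳ j)
↑-cases {n₁} x with splitAt n₁ x in eq
... | inj₁ i = inj₁ (i , sym (splitAt⁻¹-↑ˡ eq))
... | inj₂ j = inj₂ (j , sym (splitAt⁻¹-↑ʳ eq))

allB-+ : ∀ n₁ n₂ (p : Fin (n₁ + n₂) → Bool) →
  allB (n₁ + n₂) p ≡ allB n₁ (p ∘ (_↑ˡ n₂)) ∧ allB n₂ (p ∘ (n₁ ↑ʳ_))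
allB-+ n₁ n₂ p = T-injective split join
  where
  open Equivalence
  split : T (allB (n₁ + n₂) p) → T (allB n₁ (p ∘ (_↑ˡ n₂)) ∧ allB n₂ (p ∘ (n₁ ↑ʳ_)))
  split t = from (T-∧ {allB n₁ _})
    (from (T-allB {n₁} _) (to (T-allB p) t ∘ (_↑ˡ n₂)) , from (T-allB {n₂} _) (to (T-allB p) t ∘ (n₁ ↑ʳ_)))
  join : T (allB n₁ (p ∘ (_↑ˡ n₂)) ∧ allB n₂ (p ∘ (n₁ ↑ʳ_))) → T (allB (n₁ + n₂) p)
  join t with to (T-∧ {allB n₁ _}) t
  ... | t₁ , t₂ = from (T-allB p) λ x → case ↑-cases {n₁} x of λ where
    (inj₁ (i , refl)) → to (T-allB {n₁} _) t₁ i
    (inj₂ (j , refl)) → to (T-allB {n₂} _) t₂ j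

allB-suc : ∀ n (p : Fin (suc n) → Bool) → allB (suc n) p ≡ p zero ∧ allB n (p ∘ suc)
allB-suc n p = trans (allB-+ 1 n p) (cong (_∧ allB n (p ∘ suc)) (∧-identityʳ (p zero)))

allB-∧ : ∀ n (p q : Fin n → Bool) → allB n (λ x → p x ∧ q x) ≡ allB n p ∧ allB n q
allB-∧ n p q = T-injective
  (λ t → from (T-∧ {allB n p}) (from (T-allB p) (proj₁ ∘ pq t) , from (T-allB q) (proj₂ ∘ pq t)))
  (λ t → let (tp , tq) = to (T-∧ {allB n p}) t in
    from (T-allB _) (λ x → from (T-∧ {p x}) (to (T-allB p) tp x , to (T-allB q) tq x)))
  where
  open Equivalence
  pq : T (allB n (λ x → p x ∧ q x)) → ∀ x → T (p x) × T (q x)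
  pq t x = to (T-∧ {p x}) (to (T-allB _) t x)

∷-congʳ : ∀ {A : Set} {n} (a : A) {v w : Fin n → A} → v ≗ w → a ∷ᵥ v ≗ a ∷ᵥ w
∷-congʳ a v≗w zero    = refl
∷-congʳ a v≗w (suc i) = v≗w i

∷-++ : ∀ {A : Set} {n₁ n₂} (a : A) (v₁ : Fin n₁ → A) (v₂ : Fin n₂ → A) →
  (a ∷ᵥ v₁) ++ᵥ v₂ ≗ a ∷ᵥ (v₁ ++ᵥ v₂)
∷-++          a v₁ v₂ zero    = refl
∷-++ {n₁ = n₁} a v₁ v₂ (suc i) with splitAt n₁ i
... | inj₁ _ = refl
... | inj₂ _ = refl

-- Opaque, so that unification can recover the summand from a goal.
opaque
  sumFuns : (n m : ℕ) → ((Fin n → ℕ) → ℕ) → ℕ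
  sumFuns n m F = sumBy (allFuns n (suc m)) (λ f → F (toℕ ∘ f))

  sumFuns-empty : ∀ {m} (F : (Fin 0 → ℕ) → ℕ) → F Preserves _≗_ ⟶ _≡_ → sumFuns 0 m F ≡ F (λ ())
  sumFuns-empty F F-cong = trans (+-identityʳ _) (F-cong (λ ()))

  sumFuns-cong : ∀ {n m : ℕ} {F G : (Fin n → ℕ) → ℕ} → (∀ v → (∀ x → v x ≤ m) → F v ≡ G v) →
    sumFuns n m F ≡ sumFuns n m G
  sumFuns-cong {n} {m} eq = sumBy-cong (allFuns n (suc m)) (λ f → eq (toℕ ∘ f) (λ x → s≤s⁻¹ (toℕ<n (f x))))

  sumFuns-distrib-+ : ∀ {n m : ℕ} (F G : (Fin n → ℕ) → ℕ) →
    sumFuns n m (λ v → F v + G v) ≡ sumFuns n m F + sumFuns n m G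
  sumFuns-distrib-+ {n} {m} F G = sumBy-distrib-+ (allFuns n (suc m)) (F ∘ (toℕ ∘_)) (G ∘ (toℕ ∘_))

  *-distribˡ-sumFuns : ∀ {n m : ℕ} c (F : (Fin n → ℕ) → ℕ) → c * sumFuns n m F ≡ sumFuns n m (λ v → c * F v)
  *-distribˡ-sumFuns {n} {m} c F = *-distribˡ-sumBy c (allFuns n (suc m)) (F ∘ (toℕ ∘_))

  *-distribʳ-sumFuns : ∀ {n m : ℕ} c (F : (Fin n → ℕ) → ℕ) → sumFuns n m F * c ≡ sumFuns n m (λ v → F v * c)
  *-distribʳ-sumFuns {n} {m} c F = *-distribʳ-sumBy c (allFuns n (suc m)) (F ∘ (toℕ ∘_))

  sumUpTo-sumFuns : ∀ {n m : ℕ} k (F : ℕ → (Fin n → ℕ) → ℕ) →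
    sumUpTo k (λ i → sumFuns n m (F i)) ≡ sumFuns n m (λ v → sumUpTo k (λ i → F i v))
  sumUpTo-sumFuns {n} {m} k F = sumUpTo-sumBy k (allFuns n (suc m)) (λ i → F i ∘ (toℕ ∘_))

  sumFuns-suc : ∀ {n m : ℕ} (F : (Fin (suc n) → ℕ) → ℕ) → F Preserves _≗_ ⟶ _≡_ →
    sumFuns (suc n) m F ≡ sumFuns n m (λ v → sumUpTo (suc m) (λ a → F (a ∷ᵥ v)))
  sumFuns-suc {n} {m} F F-cong = trans (sumBy-concatMap _ (allFuns n (suc m)) _)
    (sumBy-cong (allFuns n (suc m)) (λ f → trans (sumBy-map _ (allFin (suc m)) _)
      (sumBy-tabulate (suc m) (λ a → a) _ (λ a → F (a ∷ᵥ (toℕ ∘ f)))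
        (λ a → F-cong λ { zero → refl ; (suc i) → refl }))))

sumFuns² : (n₁ n₂ m : ℕ) → ((Fin n₁ → ℕ) → (Fin n₂ → ℕ) → ℕ) → ℕ
sumFuns² n₁ n₂ m Φ = sumFuns n₂ m (λ v₂ → sumFuns n₁ m (λ v₁ → Φ v₁ v₂))

module _ {n₁ n₂ m : ℕ} where

  sumFuns²-cong : {Φ Ψ : (Fin n₁ → ℕ) → (Fin n₂ → ℕ) → ℕ} →
    (∀ v₁ v₂ → (∀ x → v₁ x ≤ m) → Φ v₁ v₂ ≡ Ψ v₁ v₂) → sumFuns² n₁ n₂ m Φ ≡ sumFuns² n₁ n₂ m Ψ
  sumFuns²-cong eq = sumFuns-cong (λ v₂ _ → sumFuns-cong (λ v₁ v₁≤m → eq v₁ v₂ v₁≤m))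

  sumFuns²-distrib-+ : (Φ Ψ : (Fin n₁ → ℕ) → (Fin n₂ → ℕ) → ℕ) →
    sumFuns² n₁ n₂ m Φ + sumFuns² n₁ n₂ m Ψ ≡ sumFuns² n₁ n₂ m (λ v₁ v₂ → Φ v₁ v₂ + Ψ v₁ v₂)
  sumFuns²-distrib-+ Φ Ψ = sym (trans
    (sumFuns-cong (λ v₂ _ → sumFuns-distrib-+ {n₁} {m} (λ v₁ → Φ v₁ v₂) (λ v₁ → Ψ v₁ v₂)))
    (sumFuns-distrib-+ {n₂} {m} (λ v₂ → sumFuns n₁ m (λ v₁ → Φ v₁ v₂)) (λ v₂ → sumFuns n₁ m (λ v₁ → Ψ v₁ v₂))))

  sumUpTo-sumFuns² : ∀ k (Φ : ℕ → (Fin n₁ → ℕ) → (Fin n₂ → ℕ) → ℕ) →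
    sumUpTo k (λ i → sumFuns² n₁ n₂ m (Φ i)) ≡ sumFuns² n₁ n₂ m (λ v₁ v₂ → sumUpTo k (λ i → Φ i v₁ v₂))
  sumUpTo-sumFuns² k Φ = trans (sumUpTo-sumFuns {n₂} {m} k (λ i v₂ → sumFuns n₁ m (λ v₁ → Φ i v₁ v₂)))
    (sumFuns-cong (λ v₂ _ → sumUpTo-sumFuns {n₁} {m} k (λ i v₁ → Φ i v₁ v₂)))

sumFuns-+ : ∀ n₁ n₂ {m} (F : (Fin (n₁ + n₂) → ℕ) → ℕ) → F Preserves _≗_ ⟶ _≡_ →
  sumFuns (n₁ + n₂) m F ≡ sumFuns² n₁ n₂ m (λ v₁ v₂ → F (v₁ ++ᵥ v₂))
sumFuns-+ zero      n₂      F F-cong =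
  sumFuns-cong (λ v₂ _ → sym (sumFuns-empty (λ v₁ → F (v₁ ++ᵥ v₂)) (λ _ → refl)))
sumFuns-+ (suc n₁) n₂ {m} F F-cong = begin
  sumFuns (suc n₁ + n₂) m F
    ≡⟨ sumFuns-suc F F-cong ⟩
  sumFuns (n₁ + n₂) m (λ v → sumUpTo (suc m) (λ a → F (a ∷ᵥ v)))
    ≡⟨ sumFuns-+ n₁ n₂ (λ v → sumUpTo (suc m) (λ a → F (a ∷ᵥ v))) (λ {v} {w} v≗w →
         sumUpTo-cong (suc m) (λ a _ → F-cong (∷-congʳ a v≗w))) ⟩
  sumFuns n₂ m (λ v₂ → sumFuns n₁ m (λ v₁ → sumUpTo (suc m) (λ a → F (a ∷ᵥ (v₁ ++ᵥ v₂)))))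
    ≡⟨ sumFuns-cong (λ v₂ _ → peel v₂) ⟩
  sumFuns n₂ m (λ v₂ → sumFuns (suc n₁) m (λ v₁ → F (v₁ ++ᵥ v₂))) ∎
  where
  open ≡-Reasoning
  peel : ∀ v₂ → sumFuns n₁ m (λ v₁ → sumUpTo (suc m) (λ a → F (a ∷ᵥ (v₁ ++ᵥ v₂))))
                  ≡ sumFuns (suc n₁) m (λ v₁ → F (v₁ ++ᵥ v₂))
  peel v₂ = begin
    sumFuns n₁ m (λ v₁ → sumUpTo (suc m) (λ a → F (a ∷ᵥ (v₁ ++ᵥ v₂))))
      ≡⟨ sumFuns-cong (λ v₁ _ → sumUpTo-cong (suc m) (λ a _ → F-cong (∷-++ a v₁ v₂))) ⟨
    sumFuns n₁ m (λ v₁ → sumUpTo (suc m) (λ a → F ((a ∷ᵥ v₁) ++ᵥ v₂)))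
      ≡⟨ sumFuns-suc (λ v₁ → F (v₁ ++ᵥ v₂)) (λ {v} {w} v≗w → F-cong (++-cong v w v≗w (λ _ → refl))) ⟨
    sumFuns (suc n₁) m (λ v₁ → F (v₁ ++ᵥ v₂)) ∎

sumFuns-* : ∀ {n₁ n₂ m} (F : (Fin n₁ → ℕ) → ℕ) (G : (Fin n₂ → ℕ) → ℕ) →
  sumFuns n₁ m F * sumFuns n₂ m G ≡ sumFuns² n₁ n₂ m (λ v₁ v₂ → F v₁ * G v₂)
sumFuns-* {n₁} {n₂} {m} F G = trans (*-distribˡ-sumFuns {n₂} {m} (sumFuns n₁ m F) G)
  (sumFuns-cong (λ v₂ _ → *-distribʳ-sumFuns {n₁} {m} (G v₂) F))

sumFuns-zero : ∀ n (F : (Fin n → ℕ) → ℕ) → F Preserves _≗_ ⟶ _≡_ → sumFuns n 0 F ≡ F (λ _ → 0)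
sumFuns-zero zero    F F-cong = trans (sumFuns-empty F F-cong) (F-cong (λ ()))
sumFuns-zero (suc n) F F-cong = begin
  sumFuns (suc n) 0 F                 ≡⟨ sumFuns-suc F F-cong ⟩
  sumFuns n 0 (λ v → F (0 ∷ᵥ v) + 0)  ≡⟨ sumFuns-zero n _ (λ v≗w → cong (_+ 0) (F-cong (∷-congʳ 0 v≗w))) ⟩
  F (0 ∷ᵥ (λ _ → 0)) + 0             ≡⟨ +-identityʳ _ ⟩
  F (0 ∷ᵥ (λ _ → 0))                 ≡⟨ F-cong (λ { zero → refl ; (suc _) → refl }) ⟩
  F (λ _ → 0)                         ∎
  where open ≡-Reasoning

sumFuns-window : ∀ n {m} k w → k + w ≤ m → (G : (Fin n → ℕ) → ℕ) → G Preserves _≗_ ⟶ _≡_ →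
  sumFuns n m (λ v → 𝟙 (allB n (inWindow k w ∘ v)) * G (λ x → v x ∸ k)) ≡ sumFuns n w G
sumFuns-window zero    k w _      G G-cong =
  trans (sumFuns-empty _ (λ v≗w → cong (_+ 0) (G-cong (cong (_∸ k) ∘ v≗w))))
        (trans (+-identityʳ _) (sym (trans (sumFuns-empty G G-cong) (G-cong (λ ())))))
sumFuns-window (suc n) {m} k w k+w≤m G G-cong = begin
  sumFuns (suc n) m F
    ≡⟨ sumFuns-suc F F-cong ⟩
  sumFuns n m (λ v → sumUpTo (suc m) (λ a → F (a ∷ᵥ v)))
    ≡⟨ sumFuns-cong (λ v _ → peel v) ⟩
  sumFuns n m (λ v → 𝟙 (allB n (inWindow k w ∘ v)) * G′ (λ x → v x ∸ k))
    ≡⟨ sumFuns-window n k w k+w≤m G′ G′-cong ⟩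
  sumFuns n w G′
    ≡⟨ sumFuns-suc G G-cong ⟨
  sumFuns (suc n) w G ∎
  where
  open ≡-Reasoning
  F : (Fin (suc n) → ℕ) → ℕ
  F v = 𝟙 (allB (suc n) (inWindow k w ∘ v)) * G (λ x → v x ∸ k)
  F-cong : F Preserves _≗_ ⟶ _≡_
  F-cong v≗w = cong₂ _*_ (cong 𝟙 (allB-cong (cong (inWindow k w) ∘ v≗w))) (G-cong (cong (_∸ k) ∘ v≗w))
  G′ : (Fin n → ℕ) → ℕ
  G′ u = sumUpTo (suc w) (λ b → G (b ∷ᵥ u))
  G′-cong : G′ Preserves _≗_ ⟶ _≡_
  G′-cong {u} {u′} u≗u′ = sumUpTo-cong (suc w) (λ b _ → G-cong (∷-congʳ b u≗u′))
  peel : ∀ v → sumUpTo (suc m) (λ a → F (a ∷ᵥ v)) ≡ 𝟙 (allB n (inWindow k w ∘ v)) * G′ (λ x → v x ∸ k)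
  peel v = begin
    sumUpTo (suc m) (λ a → F (a ∷ᵥ v))
      ≡⟨ sumUpTo-cong (suc m) (λ a _ → split a) ⟩
    sumUpTo (suc m) (λ a → c * (𝟙 (inWindow k w a) * G ((a ∸ k) ∷ᵥ u)))
      ≡⟨ *-distribˡ-sumUpTo c (suc m) (λ a → 𝟙 (inWindow k w a) * G ((a ∸ k) ∷ᵥ u)) ⟨
    c * sumUpTo (suc m) (λ a → 𝟙 (inWindow k w a) * G ((a ∸ k) ∷ᵥ u))
      ≡⟨ cong (c *_) (sumUpTo-window m k w k+w≤m (λ b → G (b ∷ᵥ u))) ⟩
    c * G′ u ∎
    where
    c = 𝟙 (allB n (inWindow k w ∘ v))
    u = λ x → v x ∸ k
    split : ∀ a → F (a ∷ᵥ v) ≡ c * (𝟙 (inWindow k w a) * G ((a ∸ k) ∷ᵥ u))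
    split a = begin
      𝟙 (allB (suc n) (inWindow k w ∘ (a ∷ᵥ v))) * G (λ x → (a ∷ᵥ v) x ∸ k)
        ≡⟨ cong₂ _*_ (trans (cong 𝟙 (allB-suc n (inWindow k w ∘ (a ∷ᵥ v)))) (𝟙-∧ (inWindow k w a) _))
                     (G-cong {y = (a ∸ k) ∷ᵥ u} (λ { zero → refl ; (suc _) → refl })) ⟩
      𝟙 (inWindow k w a) * c * G ((a ∸ k) ∷ᵥ u)
        ≡⟨ trans (cong (_* G ((a ∸ k) ∷ᵥ u)) (*-comm (𝟙 (inWindow k w a)) c)) (*-assoc c _ _) ⟩
      c * (𝟙 (inWindow k w a) * G ((a ∸ k) ∷ᵥ u)) ∎

maxOf : ∀ n → (Fin n → ℕ) → ℕ
maxOf zero    v = 0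
maxOf (suc n) v = v zero ⊔ maxOf n (v ∘ suc)

minOf : ℕ → ∀ n → (Fin n → ℕ) → ℕ
minOf m zero    v = m
minOf m (suc n) v = v zero ⊓ minOf m n (v ∘ suc)

≤-maxOf : ∀ n (v : Fin n → ℕ) x → v x ≤ maxOf n v
≤-maxOf (suc n) v zero    = m≤m⊔n _ _
≤-maxOf (suc n) v (suc x) = ≤-trans (≤-maxOf n (v ∘ suc) x) (m≤n⊔m _ _)

maxOf-≤ : ∀ n (v : Fin n → ℕ) {k} → (∀ x → v x ≤ k) → maxOf n v ≤ k
maxOf-≤ zero    v bound = z≤n
maxOf-≤ (suc n) v bound = ⊔-lub (bound zero) (maxOf-≤ n (v ∘ suc) (bound ∘ suc))

minOf-≤ : ∀ m n (v : Fin n → ℕ) x → minOf m n v ≤ v x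
minOf-≤ m (suc n) v zero    = m⊓n≤m _ _
minOf-≤ m (suc n) v (suc x) = ≤-trans (m⊓n≤n _ _) (minOf-≤ m n (v ∘ suc) x)

minOf-≤-bound : ∀ m n (v : Fin n → ℕ) → minOf m n v ≤ m
minOf-≤-bound m zero    v = ≤-refl
minOf-≤-bound m (suc n) v = ≤-trans (m⊓n≤n _ _) (minOf-≤-bound m n (v ∘ suc))

≤-minOf : ∀ m n (v : Fin n → ℕ) {k} → k ≤ m → (∀ x → k ≤ v x) → k ≤ minOf m n v
≤-minOf m zero    v k≤m bound = k≤m
≤-minOf m (suc n) v k≤m bound = ⊓-glb (bound zero) (≤-minOf m n (v ∘ suc) k≤m (bound ∘ suc))

module _ {n : ℕ} (v : Fin n → ℕ) where
  open Equivalence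

  allB-≤ᵇ-maxOf : ∀ k → allB n (λ x → v x ≤ᵇ k) ≡ (maxOf n v ≤ᵇ k)
  allB-≤ᵇ-maxOf k = T-injective
    (λ t → ≤⇒≤ᵇ (maxOf-≤ n v (λ x → ≤ᵇ⇒≤ _ _ (to (T-allB _) t x))))
    (λ t → from (T-allB _) (λ x → ≤⇒≤ᵇ (≤-trans (≤-maxOf n v x) (≤ᵇ⇒≤ _ _ t))))

  allB-≤ᵇ-minOf : ∀ m k → k ≤ m → allB n (λ x → k ≤ᵇ v x) ≡ (k ≤ᵇ minOf m n v)
  allB-≤ᵇ-minOf m k k≤m = T-injective
    (λ t → ≤⇒≤ᵇ (≤-minOf m n v k≤m (λ x → ≤ᵇ⇒≤ _ _ (to (T-allB _) t x))))
    (λ t → from (T-allB _) (λ x → ≤⇒≤ᵇ (≤-trans (≤ᵇ⇒≤ k _ t) (minOf-≤ m n v x))))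

allB-allB-≤ᵇ : ∀ m {n₁ n₂} (v₁ : Fin n₁ → ℕ) (v₂ : Fin n₂ → ℕ) → (∀ x → v₁ x ≤ m) →
  allB n₁ (λ x → allB n₂ (λ y → v₁ x ≤ᵇ v₂ y)) ≡ (maxOf n₁ v₁ ≤ᵇ minOf m n₂ v₂)
allB-allB-≤ᵇ m {n₁} {n₂} v₁ v₂ v₁≤m = T-injective
  (λ t → ≤⇒≤ᵇ (≤-minOf m n₂ v₂ (maxOf-≤ n₁ v₁ v₁≤m)
    (λ y → maxOf-≤ n₁ v₁ (λ x → ≤ᵇ⇒≤ _ _ (to (T-allB _) (to (T-allB _) t x) y)))))
  (λ t → from (T-allB _) (λ x → from (T-allB _) (λ y →
    ≤⇒≤ᵇ (≤-trans (≤-maxOf n₁ v₁ x) (≤-trans (≤ᵇ⇒≤ _ _ t) (minOf-≤ m n₂ v₂ y))))))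
  where open Equivalence

separation-telescope : ∀ m {n₁ n₂} (v₁ : Fin n₁ → ℕ) (v₂ : Fin n₂ → ℕ) → (∀ x → v₁ x ≤ m) →
  𝟙 (allB n₁ (λ x → allB n₂ (λ y → v₁ x ≤ᵇ v₂ y)))
    + sumUpTo m (λ k → 𝟙 (allB n₁ (λ x → v₁ x ≤ᵇ k)) * 𝟙 (allB n₂ (λ y → suc k ≤ᵇ v₂ y)))
  ≡ sumUpTo (suc m) (λ k → 𝟙 (allB n₁ (λ x → v₁ x ≤ᵇ k)) * 𝟙 (allB n₂ (λ y → k ≤ᵇ v₂ y)))
separation-telescope m {n₁} {n₂} v₁ v₂ v₁≤m = begin
  𝟙 (allB n₁ (λ x → allB n₂ (λ y → v₁ x ≤ᵇ v₂ y)))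
    + sumUpTo m (λ k → 𝟙 (allB n₁ (λ x → v₁ x ≤ᵇ k)) * 𝟙 (allB n₂ (λ y → suc k ≤ᵇ v₂ y)))
    ≡⟨ cong₂ _+_ (cong 𝟙 (allB-allB-≤ᵇ m v₁ v₂ v₁≤m))
         (sumUpTo-cong m (λ k k<m → extremes k (suc k) k<m)) ⟩
  𝟙 (M₁ ≤ᵇ M₂) + sumUpTo m (λ k → 𝟙 (M₁ ≤ᵇ k) * 𝟙 (suc k ≤ᵇ M₂))
    ≡⟨ interval-telescope m M₁ M₂ (maxOf-≤ n₁ v₁ v₁≤m) (minOf-≤-bound m n₂ v₂) ⟩
  sumUpTo (suc m) (λ k → 𝟙 (M₁ ≤ᵇ k) * 𝟙 (k ≤ᵇ M₂))
    ≡⟨ sumUpTo-cong (suc m) (λ k k≤m → extremes k k (s≤s⁻¹ k≤m)) ⟨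
  sumUpTo (suc m) (λ k → 𝟙 (allB n₁ (λ x → v₁ x ≤ᵇ k)) * 𝟙 (allB n₂ (λ y → k ≤ᵇ v₂ y))) ∎
  where
  open ≡-Reasoning
  M₁ = maxOf n₁ v₁
  M₂ = minOf m n₂ v₂
  extremes : ∀ k k′ → k′ ≤ m →
    𝟙 (allB n₁ (λ x → v₁ x ≤ᵇ k)) * 𝟙 (allB n₂ (λ y → k′ ≤ᵇ v₂ y)) ≡ 𝟙 (M₁ ≤ᵇ k) * 𝟙 (k′ ≤ᵇ M₂)
  extremes k k′ k′≤m = cong₂ (λ a b → 𝟙 a * 𝟙 b) (allB-≤ᵇ-maxOf v₁ k) (allB-≤ᵇ-minOf v₂ m k′ k′≤m)

isMonotone : ∀ n → (Fin n → Fin n → Bool) → (Fin n → ℕ) → Bool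
isMonotone n le v = allB n (λ x → allB n (λ y → not (le x y) ∨ (v x ≤ᵇ v y)))

isInvariant : ∀ n → (Fin n → Fin n) → (Fin n → ℕ) → Bool
isInvariant n σ v = allB n (λ x → v (σ x) ≡ᵇ v x)

weight : ∀ n → (Fin n → Fin n → Bool) → (Fin n → Fin n) → (Fin n → ℕ) → ℕ
weight n le σ v = if isMonotone n le v then (if isInvariant n σ v then 1 else 0) else 0

opaque
  unfolding sumFuns

  fixedLatticePoints-sumFuns : ∀ n le σ m → fixedLatticePoints n le σ m ≡ sumFuns n m (weight n le σ)
  fixedLatticePoints-sumFuns n le σ m = refl

∸-≤ᵇ-∸ : ∀ {a b} k → k ≤ a → k ≤ b → (a ∸ k ≤ᵇ b ∸ k) ≡ (a ≤ᵇ b)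
∸-≤ᵇ-∸ {a} {b} k k≤a k≤b = T-injective
  (λ t → ≤⇒≤ᵇ (subst₂ _≤_ (m∸n+n≡m k≤a) (m∸n+n≡m k≤b) (+-monoˡ-≤ k (≤ᵇ⇒≤ _ _ t))))
  (λ t → ≤⇒≤ᵇ (∸-monoˡ-≤ k (≤ᵇ⇒≤ _ _ t)))

∸-≡ᵇ-∸ : ∀ {a b} k → k ≤ a → k ≤ b → (a ∸ k ≡ᵇ b ∸ k) ≡ (a ≡ᵇ b)
∸-≡ᵇ-∸ {a} {b} k k≤a k≤b = T-injective
  (λ t → ≡⇒≡ᵇ a b (∸-cancelʳ-≡ k≤a k≤b (≡ᵇ⇒≡ _ _ t)))
  (λ t → ≡⇒≡ᵇ _ _ (cong (_∸ k) (≡ᵇ⇒≡ a b t)))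

module _ {n : ℕ} (le : Fin n → Fin n → Bool) (σ : Fin n → Fin n) where

  weight-𝟙 : ∀ v → weight n le σ v ≡ 𝟙 (isMonotone n le v) * 𝟙 (isInvariant n σ v)
  weight-𝟙 v with isMonotone n le v
  ... | false = refl
  ... | true  = sym (+-identityʳ _)

  weight-cong : weight n le σ Preserves _≗_ ⟶ _≡_
  weight-cong v≗w = cong₂ (λ a b → if a then (if b then 1 else 0) else 0)
    (allB-cong (λ x → allB-cong (λ y → cong₂ (λ a b → not (le x y) ∨ (a ≤ᵇ b)) (v≗w x) (v≗w y))))
    (allB-cong (λ x → cong₂ _≡ᵇ_ (v≗w (σ x)) (v≗w x)))

  weight-∸ : ∀ k v → (∀ x → k ≤ v x) → weight n le σ (λ x → v x ∸ k) ≡ weight n le σ v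
  weight-∸ k v k≤v = cong₂ (λ a b → if a then (if b then 1 else 0) else 0)
    (allB-cong (λ x → allB-cong (λ y → cong (not (le x y) ∨_) (∸-≤ᵇ-∸ k (k≤v x) (k≤v y)))))
    (allB-cong (λ x → ∸-≡ᵇ-∸ k (k≤v (σ x)) (k≤v x)))

  weight-const-0 : weight n le σ (λ _ → 0) ≡ 1
  weight-const-0 = trans (cong (λ b → if b then 𝟙 (isInvariant n σ (λ _ → 0)) else 0) isMonotone-const)
                         (cong 𝟙 (allB-true {n}))
    where
    open Equivalence
    ∨-true : ∀ b → T (b ∨ true)
    ∨-true false = tt
    ∨-true true  = tt
    isMonotone-const : isMonotone n le (λ _ → 0) ≡ true
    isMonotone-const = T-injective _ (λ _ → from (T-allB _) λ x → from (T-allB _) λ y → ∨-true (not (le x y)))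

  fixedLatticePoints-zero : fixedLatticePoints n le σ 0 ≡ 1
  fixedLatticePoints-zero =
    trans (fixedLatticePoints-sumFuns n le σ 0)
          (trans (sumFuns-zero n (weight n le σ) weight-cong) weight-const-0)

  fixedLatticePoints-≤ : ∀ {m} k → k ≤ m →
    fixedLatticePoints n le σ k ≡ sumFuns n m (λ v → 𝟙 (allB n (λ x → v x ≤ᵇ k)) * weight n le σ v)
  fixedLatticePoints-≤ k k≤m =
    trans (fixedLatticePoints-sumFuns n le σ k) (sym (sumFuns-window n 0 k k≤m (weight n le σ) weight-cong))

  fixedLatticePoints-∸ : ∀ {m} k → k ≤ m →
    fixedLatticePoints n le σ (m ∸ k) ≡ sumFuns n m (λ v → 𝟙 (allB n (λ x → k ≤ᵇ v x)) * weight n le σ v)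
  fixedLatticePoints-∸ {m} k k≤m = begin
    fixedLatticePoints n le σ (m ∸ k)
      ≡⟨ fixedLatticePoints-sumFuns n le σ (m ∸ k) ⟩
    sumFuns n (m ∸ k) (weight n le σ)
      ≡⟨ sumFuns-window n k (m ∸ k) (≤-reflexive (m+[n∸m]≡n k≤m)) (weight n le σ) weight-cong ⟨
    sumFuns n m (λ v → 𝟙 (allB n (inWindow k (m ∸ k) ∘ v)) * weight n le σ (λ x → v x ∸ k))
      ≡⟨ sumFuns-cong above ⟩
    sumFuns n m (λ v → 𝟙 (allB n (λ x → k ≤ᵇ v x)) * weight n le σ v) ∎
    where
    open ≡-Reasoning
    above : ∀ v → (∀ x → v x ≤ m) →
      𝟙 (allB n (inWindow k (m ∸ k) ∘ v)) * weight n le σ (λ x → v x ∸ k)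
        ≡ 𝟙 (allB n (λ x → k ≤ᵇ v x)) * weight n le σ v
    above v v≤m = begin
      𝟙 (allB n (inWindow k (m ∸ k) ∘ v)) * weight n le σ (λ x → v x ∸ k)
        ≡⟨ cong (λ b → 𝟙 b * weight n le σ (λ x → v x ∸ k)) (allB-cong below-top) ⟩
      𝟙 (allB n (λ x → k ≤ᵇ v x)) * weight n le σ (λ x → v x ∸ k)
        ≡⟨ 𝟙*-cong (allB n (λ x → k ≤ᵇ v x))
             (λ t → weight-∸ k v (λ x → ≤ᵇ⇒≤ k _ (Equivalence.to (T-allB _) t x))) ⟩
      𝟙 (allB n (λ x → k ≤ᵇ v x)) * weight n le σ v ∎
      where
      below-top : ∀ x → inWindow k (m ∸ k) (v x) ≡ (k ≤ᵇ v x)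
      below-top x = trans (cong ((k ≤ᵇ v x) ∧_) (T-injective _ (λ _ → ≤⇒≤ᵇ v≤k+[m∸k])))
                          (∧-identityʳ _)
        where
        v≤k+[m∸k] : v x ≤ k + (m ∸ k)
        v≤k+[m∸k] = subst (v x ≤_) (sym (m+[n∸m]≡n k≤m)) (v≤m x)

ehrCoeff-fixedLatticePoints : ∀ n le σ m → ehrCoeff n le σ m ≡ ℤ.+ fixedLatticePoints n le σ m
ehrCoeff-fixedLatticePoints n le σ zero    = cong ℤ.+_ (sym (fixedLatticePoints-zero le σ))
ehrCoeff-fixedLatticePoints n le σ (suc m) = refl

foldr-+-applyUpTo : (u : ℕ → ℤ) (w : ℕ → ℕ) → (∀ i → u i ≡ ℤ.+ w i) → ∀ n (f : ℕ → ℕ) →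
  foldr ℤ._+_ (ℤ.+ 0) (map u (applyUpTo f n)) ≡ ℤ.+ sumUpTo n (w ∘ f)
foldr-+-applyUpTo u w u≡w zero    f = refl
foldr-+-applyUpTo u w u≡w (suc n) f =
  trans (cong₂ ℤ._+_ (u≡w (f 0)) (foldr-+-applyUpTo u w u≡w n (f ∘ suc))) (sym (ℤ.pos-+ (w (f 0)) _))

⊛-pos : (a b : Series) (a′ b′ : ℕ → ℕ) → (∀ k → a k ≡ ℤ.+ a′ k) → (∀ k → b k ≡ ℤ.+ b′ k) →
  ∀ m → (a ⊛ b) m ≡ ℤ.+ sumUpTo (suc m) (λ k → a′ k * b′ (m ∸ k))
⊛-pos a b a′ b′ a≡a′ b≡b′ m = foldr-+-applyUpTo _ (λ k → a′ k * b′ (m ∸ k))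
  (λ k → trans (cong₂ ℤ._*_ (a≡a′ k) (b≡b′ (m ∸ k))) (sym (ℤ.pos-* (a′ k) (b′ (m ∸ k))))) (suc m) (λ k → k)

pos-+-minus : ∀ a d → ℤ.+ (a + d) ℤ.- ℤ.+ d ≡ ℤ.+ a
pos-+-minus a d = trans (ℤ.m-n≡m⊖n (a + d) d) (trans (ℤ.⊖-≥ (m≤n+m d a)) (cong ℤ.+_ (m+n∸n≡m a d)))

oneMinusT-telescope : (a D : ℕ → ℕ) (s : Series) → (∀ m → s m ≡ ℤ.+ D m) →
  a 0 + 0 ≡ D 0 → (∀ m → a (suc m) + D m ≡ D (suc m)) → ∀ m → ℤ.+ a m ≡ oneMinusT s m
oneMinusT-telescope a D s s≡D a₀ aₛ zero    =
  trans (cong ℤ.+_ (trans (sym (+-identityʳ (a 0))) a₀)) (sym (s≡D 0))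
oneMinusT-telescope a D s s≡D a₀ aₛ (suc m) = begin
  ℤ.+ a (suc m)                           ≡⟨ pos-+-minus (a (suc m)) (D m) ⟨
  ℤ.+ (a (suc m) + D m) ℤ.- ℤ.+ D m       ≡⟨ cong₂ (λ x y → ℤ.+ x ℤ.- y) (aₛ m) (sym (s≡D m)) ⟩
  ℤ.+ D (suc m) ℤ.- s m                   ≡⟨ cong (ℤ._- s m) (s≡D (suc m)) ⟨
  s (suc m) ℤ.- s m                       ∎
  where open ≡-Reasoning

module Join (X₁ X₂ : FinPoset) where

  n₁ n₂ : ℕ
  n₁ = size X₁
  n₂ = size X₂

  joinLeq-↑ˡ-↑ˡ : ∀ i i′ → joinLeq X₁ X₂ (i ↑ˡ n₂) (i′ ↑ˡ n₂) ≡ leq X₁ i i′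
  joinLeq-↑ˡ-↑ˡ i i′ rewrite splitAt-↑ˡ n₁ i n₂ | splitAt-↑ˡ n₁ i′ n₂ = refl

  joinLeq-↑ˡ-↑ʳ : ∀ i j → joinLeq X₁ X₂ (i ↑ˡ n₂) (n₁ ↑ʳ j) ≡ true
  joinLeq-↑ˡ-↑ʳ i j rewrite splitAt-↑ˡ n₁ i n₂ | splitAt-↑ʳ n₁ n₂ j = refl

  joinLeq-↑ʳ-↑ˡ : ∀ j i → joinLeq X₁ X₂ (n₁ ↑ʳ j) (i ↑ˡ n₂) ≡ false
  joinLeq-↑ʳ-↑ˡ j i rewrite splitAt-↑ʳ n₁ n₂ j | splitAt-↑ˡ n₁ i n₂ = refl

  joinLeq-↑ʳ-↑ʳ : ∀ j j′ → joinLeq X₁ X₂ (n₁ ↑ʳ j) (n₁ ↑ʳ j′) ≡ leq X₂ j j′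
  joinLeq-↑ʳ-↑ʳ j j′ rewrite splitAt-↑ʳ n₁ n₂ j | splitAt-↑ʳ n₁ n₂ j′ = refl

  module _ (v₁ : Fin n₁ → ℕ) (v₂ : Fin n₂ → ℕ) where

    separated : Bool
    separated = allB n₁ (λ i → allB n₂ (λ j → v₁ i ≤ᵇ v₂ j))

    isMonotone-++ : isMonotone (n₁ + n₂) (joinLeq X₁ X₂) (v₁ ++ᵥ v₂)
                      ≡ (isMonotone n₁ (leq X₁) v₁ ∧ separated) ∧ isMonotone n₂ (leq X₂) v₂
    isMonotone-++ = begin
      allB (n₁ + n₂) (λ x → allB (n₁ + n₂) (edge x))
        ≡⟨ allB-+ n₁ n₂ _ ⟩
      allB n₁ (λ i → allB (n₁ + n₂) (edge (i ↑ˡ n₂))) ∧ allB n₂ (λ j → allB (n₁ + n₂) (edge (n₁ ↑ʳ j)))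
        ≡⟨ cong₂ _∧_ (allB-cong rowˡ) (allB-cong rowʳ) ⟩
      allB n₁ (λ i → mono₁ i ∧ allB n₂ (λ j → v₁ i ≤ᵇ v₂ j)) ∧ isMonotone n₂ (leq X₂) v₂
        ≡⟨ cong (_∧ isMonotone n₂ (leq X₂) v₂) (allB-∧ n₁ mono₁ _) ⟩
      (isMonotone n₁ (leq X₁) v₁ ∧ separated) ∧ isMonotone n₂ (leq X₂) v₂ ∎
      where
      open ≡-Reasoning
      w = v₁ ++ᵥ v₂
      edge : Fin (n₁ + n₂) → Fin (n₁ + n₂) → Bool
      edge x y = not (joinLeq X₁ X₂ x y) ∨ (w x ≤ᵇ w y)
      mono₁ : Fin n₁ → Bool
      mono₁ i = allB n₁ (λ i′ → not (leq X₁ i i′) ∨ (v₁ i ≤ᵇ v₁ i′))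
      rowˡ : ∀ i → allB (n₁ + n₂) (edge (i ↑ˡ n₂)) ≡ mono₁ i ∧ allB n₂ (λ j → v₁ i ≤ᵇ v₂ j)
      rowˡ i = trans (allB-+ n₁ n₂ _) (cong₂ _∧_
        (allB-cong (λ i′ → cong₂ (λ b c → not b ∨ c) (joinLeq-↑ˡ-↑ˡ i i′)
                              (cong₂ _≤ᵇ_ (lookup-++ˡ v₁ v₂ i) (lookup-++ˡ v₁ v₂ i′))))
        (allB-cong (λ j → cong₂ (λ b c → not b ∨ c) (joinLeq-↑ˡ-↑ʳ i j)
                              (cong₂ _≤ᵇ_ (lookup-++ˡ v₁ v₂ i) (lookup-++ʳ v₁ v₂ j)))))
      rowʳ : ∀ j → allB (n₁ + n₂) (edge (n₁ ↑ʳ j)) ≡ allB n₂ (λ j′ → not (leq X₂ j j′) ∨ (v₂ j ≤ᵇ v₂ j′))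
      rowʳ j = trans (allB-+ n₁ n₂ _) (cong₂ _∧_
        (trans (allB-cong (λ i → cong (λ b → not b ∨ (w (n₁ ↑ʳ j) ≤ᵇ w (i ↑ˡ n₂))) (joinLeq-↑ʳ-↑ˡ j i)))
               (allB-true {n₁}))
        (allB-cong (λ j′ → cong₂ (λ b c → not b ∨ c) (joinLeq-↑ʳ-↑ʳ j j′)
                              (cong₂ _≤ᵇ_ (lookup-++ʳ v₁ v₂ j) (lookup-++ʳ v₁ v₂ j′)))))

    isInvariant-++ : ∀ σ σ₁ σ₂ → (∀ i → σ (i ↑ˡ n₂) ≡ σ₁ i ↑ˡ n₂) → (∀ j → σ (n₁ ↑ʳ j) ≡ n₁ ↑ʳ σ₂ j) →
      isInvariant (n₁ + n₂) σ (v₁ ++ᵥ v₂) ≡ isInvariant n₁ σ₁ v₁ ∧ isInvariant n₂ σ₂ v₂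
    isInvariant-++ σ σ₁ σ₂ σˡ σʳ = trans (allB-+ n₁ n₂ _) (cong₂ _∧_
      (allB-cong (λ i → cong₂ _≡ᵇ_ (trans (cong (v₁ ++ᵥ v₂) (σˡ i)) (lookup-++ˡ v₁ v₂ (σ₁ i)))
                                   (lookup-++ˡ v₁ v₂ i)))
      (allB-cong (λ j → cong₂ _≡ᵇ_ (trans (cong (v₁ ++ᵥ v₂) (σʳ j)) (lookup-++ʳ v₁ v₂ (σ₂ j)))
                                   (lookup-++ʳ v₁ v₂ j))))

    weight-++ : ∀ σ σ₁ σ₂ → (∀ i → σ (i ↑ˡ n₂) ≡ σ₁ i ↑ˡ n₂) → (∀ j → σ (n₁ ↑ʳ j) ≡ n₁ ↑ʳ σ₂ j) →
      weight (n₁ + n₂) (joinLeq X₁ X₂) σ (v₁ ++ᵥ v₂)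
        ≡ 𝟙 separated * (weight n₁ (leq X₁) σ₁ v₁ * weight n₂ (leq X₂) σ₂ v₂)
    weight-++ σ σ₁ σ₂ σˡ σʳ = begin
      weight (n₁ + n₂) (joinLeq X₁ X₂) σ (v₁ ++ᵥ v₂)
        ≡⟨ weight-𝟙 (joinLeq X₁ X₂) σ (v₁ ++ᵥ v₂) ⟩
      𝟙 (isMonotone (n₁ + n₂) (joinLeq X₁ X₂) (v₁ ++ᵥ v₂)) * 𝟙 (isInvariant (n₁ + n₂) σ (v₁ ++ᵥ v₂))
        ≡⟨ cong₂ (λ a b → 𝟙 a * 𝟙 b) isMonotone-++ (isInvariant-++ σ σ₁ σ₂ σˡ σʳ) ⟩
      𝟙 ((mono₁ ∧ separated) ∧ mono₂) * 𝟙 (inv₁ ∧ inv₂)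
        ≡⟨ cong₂ _*_ (trans (𝟙-∧ (mono₁ ∧ separated) mono₂) (cong (_* 𝟙 mono₂) (𝟙-∧ mono₁ separated)))
                     (𝟙-∧ inv₁ inv₂) ⟩
      𝟙 mono₁ * 𝟙 separated * 𝟙 mono₂ * (𝟙 inv₁ * 𝟙 inv₂)
        ≡⟨ regroup (𝟙 mono₁) (𝟙 mono₂) (𝟙 separated) (𝟙 inv₁) (𝟙 inv₂) ⟩
      𝟙 separated * (𝟙 mono₁ * 𝟙 inv₁ * (𝟙 mono₂ * 𝟙 inv₂))
        ≡⟨ cong (𝟙 separated *_) (cong₂ _*_ (weight-𝟙 (leq X₁) σ₁ v₁) (weight-𝟙 (leq X₂) σ₂ v₂)) ⟨
      𝟙 separated * (weight n₁ (leq X₁) σ₁ v₁ * weight n₂ (leq X₂) σ₂ v₂) ∎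
      where
      open ≡-Reasoning
      mono₁ = isMonotone n₁ (leq X₁) v₁
      mono₂ = isMonotone n₂ (leq X₂) v₂
      inv₁  = isInvariant n₁ σ₁ v₁
      inv₂  = isInvariant n₂ σ₂ v₂
      regroup : ∀ a b c d e → a * c * b * (d * e) ≡ c * (a * d * (b * e))
      regroup = solve-∀

  ↑ˡ≢↑ʳ : ∀ {i j} → i ↑ˡ n₂ ≢ n₁ ↑ʳ j
  ↑ˡ≢↑ʳ {i} {j} eq
    with () ← trans (sym (splitAt-↑ˡ n₁ i n₂)) (trans (cong (splitAt n₁) eq) (splitAt-↑ʳ n₁ n₂ j))

  joinLeq-↑ʳ-upward : ∀ j y → joinLeq X₁ X₂ (n₁ ↑ʳ j) y ≡ true → ∃ λ j′ → y ≡ n₁ ↑ʳ j′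
  joinLeq-↑ʳ-upward j y j≤y with ↑-cases {n₁} y
  ... | inj₂ y∈X₂      = y∈X₂
  ... | inj₁ (i , refl) with () ← trans (sym (joinLeq-↑ʳ-↑ˡ j i)) j≤y

  module _ (φ : Fin (n₁ + n₂) → Fin (n₁ + n₂))
           (φ-mono : ∀ x y → joinLeq X₁ X₂ (φ x) (φ y) ≡ joinLeq X₁ X₂ x y) where

    automorphism-↑ˡ : Injective _≡_ _≡_ φ → ∀ i → ∃ λ i′ → φ (i ↑ˡ n₂) ≡ i′ ↑ˡ n₂
    automorphism-↑ˡ φ-inj i with ↑-cases {n₁} (φ (i ↑ˡ n₂))
    ... | inj₁ φi∈X₁        = φi∈X₁
    ... | inj₂ (j₀ , φi≡j₀) = ⊥-elim (<⇒notInjective (n<1+n n₂) ψ-injective)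
      where
      embed : Fin (suc n₂) → Fin (n₁ + n₂)
      embed = (i ↑ˡ n₂) ∷ᵥ (n₁ ↑ʳ_)
      embed-injective : Injective _≡_ _≡_ embed
      embed-injective {zero}  {zero}  _  = refl
      embed-injective {zero}  {suc _} eq = ⊥-elim (↑ˡ≢↑ʳ eq)
      embed-injective {suc _} {zero}  eq = ⊥-elim (↑ˡ≢↑ʳ (sym eq))
      embed-injective {suc j} {suc k} eq = cong suc (↑ʳ-injective n₁ j k eq)
      φ-X₂ : ∀ j → ∃ λ j′ → φ (n₁ ↑ʳ j) ≡ n₁ ↑ʳ j′
      φ-X₂ j = joinLeq-↑ʳ-upward j₀ (φ (n₁ ↑ʳ j))
        (trans (cong (λ x → joinLeq X₁ X₂ x (φ (n₁ ↑ʳ j))) (sym φi≡j₀))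
               (trans (φ-mono _ _) (joinLeq-↑ˡ-↑ʳ i j)))
      ψ : Fin (suc n₂) → Fin n₂
      ψ = j₀ ∷ᵥ (proj₁ ∘ φ-X₂)
      φ∘embed : ∀ k → φ (embed k) ≡ n₁ ↑ʳ ψ k
      φ∘embed zero    = φi≡j₀
      φ∘embed (suc j) = proj₂ (φ-X₂ j)
      ψ-injective : Injective _≡_ _≡_ ψ
      ψ-injective {k} {k′} eq =
        embed-injective (φ-inj (trans (φ∘embed k) (trans (cong (n₁ ↑ʳ_) eq) (sym (φ∘embed k′)))))

    automorphism-↑ʳ : (φ⁻¹ : Fin (n₁ + n₂) → Fin (n₁ + n₂)) → (∀ x → φ⁻¹ (φ x) ≡ x) →
      (∀ i → ∃ λ i′ → φ⁻¹ (i ↑ˡ n₂) ≡ i′ ↑ˡ n₂) → ∀ j → ∃ λ j′ → φ (n₁ ↑ʳ j) ≡ n₁ ↑ʳ j′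
    automorphism-↑ʳ φ⁻¹ φ⁻¹∘φ φ⁻¹-X₁ j with ↑-cases {n₁} (φ (n₁ ↑ʳ j))
    ... | inj₂ φj∈X₂       = φj∈X₂
    ... | inj₁ (i , φj≡i) = ⊥-elim (↑ˡ≢↑ʳ (sym (begin
      n₁ ↑ʳ j                ≡⟨ φ⁻¹∘φ (n₁ ↑ʳ j) ⟨
      φ⁻¹ (φ (n₁ ↑ʳ j))      ≡⟨ cong φ⁻¹ φj≡i ⟩
      φ⁻¹ (i ↑ˡ n₂)          ≡⟨ proj₂ (φ⁻¹-X₁ i) ⟩
      proj₁ (φ⁻¹-X₁ i) ↑ˡ n₂ ∎)))
      where open ≡-Reasoning

  module Ehrhart
    (σ : Fin (n₁ + n₂) → Fin (n₁ + n₂)) (σ₁ : Fin n₁ → Fin n₁) (σ₂ : Fin n₂ → Fin n₂)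
    (σˡ : ∀ i → σ (i ↑ˡ n₂) ≡ σ₁ i ↑ˡ n₂) (σʳ : ∀ j → σ (n₁ ↑ʳ j) ≡ n₁ ↑ʳ σ₂ j) where

    N N₁ N₂ : ℕ → ℕ
    N  = fixedLatticePoints (n₁ + n₂) (joinLeq X₁ X₂) σ
    N₁ = fixedLatticePoints n₁ (leq X₁) σ₁
    N₂ = fixedLatticePoints n₂ (leq X₂) σ₂

    private
      w₁ : (Fin n₁ → ℕ) → ℕ
      w₁ = weight n₁ (leq X₁) σ₁
      w₂ : (Fin n₂ → ℕ) → ℕ
      w₂ = weight n₂ (leq X₂) σ₂
      below : ℕ → (Fin n₁ → ℕ) → ℕ
      below k v₁ = 𝟙 (allB n₁ (λ x → v₁ x ≤ᵇ k))
      above : ℕ → (Fin n₂ → ℕ) → ℕ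
      above k v₂ = 𝟙 (allB n₂ (λ y → k ≤ᵇ v₂ y))
      split : ℕ → ℕ → (Fin n₁ → ℕ) → (Fin n₂ → ℕ) → ℕ
      split k k′ v₁ v₂ = below k v₁ * w₁ v₁ * (above k′ v₂ * w₂ v₂)

    N-sumFuns² : ∀ m → N m ≡ sumFuns² n₁ n₂ m (λ v₁ v₂ → 𝟙 (separated v₁ v₂) * (w₁ v₁ * w₂ v₂))
    N-sumFuns² m = begin
      N m
        ≡⟨ fixedLatticePoints-sumFuns (n₁ + n₂) (joinLeq X₁ X₂) σ m ⟩
      sumFuns (n₁ + n₂) m w
        ≡⟨ sumFuns-+ n₁ n₂ w (weight-cong (joinLeq X₁ X₂) σ) ⟩
      sumFuns² n₁ n₂ m (λ v₁ v₂ → w (v₁ ++ᵥ v₂))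
        ≡⟨ sumFuns²-cong (λ v₁ v₂ _ → weight-++ v₁ v₂ σ σ₁ σ₂ σˡ σʳ) ⟩
      sumFuns² n₁ n₂ m (λ v₁ v₂ → 𝟙 (separated v₁ v₂) * (w₁ v₁ * w₂ v₂)) ∎
      where
      open ≡-Reasoning
      w = weight (n₁ + n₂) (joinLeq X₁ X₂) σ

    N₁*N₂-sumFuns² : ∀ {m} k k′ → k ≤ m → k′ ≤ m → N₁ k * N₂ (m ∸ k′) ≡ sumFuns² n₁ n₂ m (split k k′)
    N₁*N₂-sumFuns² k k′ k≤m k′≤m =
      trans (cong₂ _*_ (fixedLatticePoints-≤ (leq X₁) σ₁ k k≤m) (fixedLatticePoints-∸ (leq X₂) σ₂ k′ k′≤m))
            (sumFuns-* _ _)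

    split-telescope : ∀ m v₁ v₂ → (∀ x → v₁ x ≤ m) →
      𝟙 (separated v₁ v₂) * (w₁ v₁ * w₂ v₂) + sumUpTo m (λ k → split k (suc k) v₁ v₂)
        ≡ sumUpTo (suc m) (λ k → split k k v₁ v₂)
    split-telescope m v₁ v₂ v₁≤m = begin
      𝟙 (separated v₁ v₂) * W + sumUpTo m (λ k → split k (suc k) v₁ v₂)
        ≡⟨ cong (𝟙 (separated v₁ v₂) * W +_) (trans (sumUpTo-cong m (λ k _ → factor k (suc k)))
             (sym (*-distribʳ-sumUpTo W m (λ k → below k v₁ * above (suc k) v₂)))) ⟩
      𝟙 (separated v₁ v₂) * W + sumUpTo m (λ k → below k v₁ * above (suc k) v₂) * W
        ≡⟨ *-distribʳ-+ W (𝟙 (separated v₁ v₂)) _ ⟨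
      (𝟙 (separated v₁ v₂) + sumUpTo m (λ k → below k v₁ * above (suc k) v₂)) * W
        ≡⟨ cong (_* W) (separation-telescope m v₁ v₂ v₁≤m) ⟩
      sumUpTo (suc m) (λ k → below k v₁ * above k v₂) * W
        ≡⟨ *-distribʳ-sumUpTo W (suc m) (λ k → below k v₁ * above k v₂) ⟩
      sumUpTo (suc m) (λ k → below k v₁ * above k v₂ * W)
        ≡⟨ sumUpTo-cong (suc m) (λ k _ → factor k k) ⟨
      sumUpTo (suc m) (λ k → split k k v₁ v₂) ∎
      where
      open ≡-Reasoning
      W = w₁ v₁ * w₂ v₂
      factor : ∀ k k′ → split k k′ v₁ v₂ ≡ below k v₁ * above k′ v₂ * W
      factor k k′ = *-interchange (below k v₁) (w₁ v₁) (above k′ v₂) (w₂ v₂)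

    fixedLatticePoints-join : ∀ m →
      N m + sumUpTo m (λ k → N₁ k * N₂ (m ∸ suc k)) ≡ sumUpTo (suc m) (λ k → N₁ k * N₂ (m ∸ k))
    fixedLatticePoints-join m = begin
      N m + sumUpTo m (λ k → N₁ k * N₂ (m ∸ suc k))
        ≡⟨ cong₂ _+_ (N-sumFuns² m) (sumUpTo-cong m (λ k k<m → N₁*N₂-sumFuns² k (suc k) (<⇒≤ k<m) k<m)) ⟩
      sumFuns² n₁ n₂ m (λ v₁ v₂ → 𝟙 (separated v₁ v₂) * (w₁ v₁ * w₂ v₂))
        + sumUpTo m (λ k → sumFuns² n₁ n₂ m (split k (suc k)))
        ≡⟨ cong (sumFuns² n₁ n₂ m _ +_) (sumUpTo-sumFuns² m (λ k → split k (suc k))) ⟩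
      sumFuns² n₁ n₂ m (λ v₁ v₂ → 𝟙 (separated v₁ v₂) * (w₁ v₁ * w₂ v₂))
        + sumFuns² n₁ n₂ m (λ v₁ v₂ → sumUpTo m (λ k → split k (suc k) v₁ v₂))
        ≡⟨ sumFuns²-distrib-+ _ _ ⟩
      sumFuns² n₁ n₂ m (λ v₁ v₂ → 𝟙 (separated v₁ v₂) * (w₁ v₁ * w₂ v₂)
                                    + sumUpTo m (λ k → split k (suc k) v₁ v₂))
        ≡⟨ sumFuns²-cong (λ v₁ v₂ v₁≤m → split-telescope m v₁ v₂ v₁≤m) ⟩
      sumFuns² n₁ n₂ m (λ v₁ v₂ → sumUpTo (suc m) (λ k → split k k v₁ v₂))
        ≡⟨ sumUpTo-sumFuns² (suc m) (λ k → split k k) ⟨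
      sumUpTo (suc m) (λ k → sumFuns² n₁ n₂ m (split k k))
        ≡⟨ sumUpTo-cong (suc m) (λ k k≤m → N₁*N₂-sumFuns² k k (s≤s⁻¹ k≤m) (s≤s⁻¹ k≤m)) ⟨
      sumUpTo (suc m) (λ k → N₁ k * N₂ (m ∸ k)) ∎
      where open ≡-Reasoning

    ehrCoeff-join : ∀ m → ehrCoeff (n₁ + n₂) (joinLeq X₁ X₂) σ m
                            ≡ oneMinusT (ehrCoeff n₁ (leq X₁) σ₁ ⊛ ehrCoeff n₂ (leq X₂) σ₂) m
    ehrCoeff-join m = trans (ehrCoeff-fixedLatticePoints _ _ σ m)
      (oneMinusT-telescope N (λ m → sumUpTo (suc m) (λ k → N₁ k * N₂ (m ∸ k))) _
        (⊛-pos _ _ N₁ N₂ (ehrCoeff-fixedLatticePoints _ _ σ₁) (ehrCoeff-fixedLatticePoints _ _ σ₂))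
        (fixedLatticePoints-join 0) (fixedLatticePoints-join ∘ suc) m)

proposition6p10 : ∀ {c ℓ : Level} (G : Group c ℓ) →
    let open Group G in
    -- G is finite
    Σ ℕ (λ k → Σ (Fin k → Carrier) (λ e → ∀ g → Σ (Fin k) (λ i → e i ≈ g))) →
    (X₁ X₂ : FinPoset) →
    (act : Carrier → Fin (size X₁ + size X₂) → Fin (size X₁ + size X₂)) →
    (∀ x → act ε x ≡ x) →
    (∀ g h x → act (g ∙ h) x ≡ act g (act h x)) →
    (∀ g h x → g ≈ h → act g x ≡ act h x) →
    -- each g acts by a poset automorphism of X₁ * X₂
    (∀ g x y → joinLeq X₁ X₂ (act g x) (act g y) ≡ joinLeq X₁ X₂ x y) →
    -- G preserves X₁ and X₂ (with restricted actions act₁, act₂) ...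
    Σ (Carrier → Fin (size X₁) → Fin (size X₁)) (λ act₁ →
    Σ (Carrier → Fin (size X₂) → Fin (size X₂)) (λ act₂ →
      (∀ g i → act g (i ↑ˡ size X₂) ≡ act₁ g i ↑ˡ size X₂) ×
      (∀ g j → act g (size X₁ ↑ʳ j) ≡ size X₁ ↑ʳ act₂ g j) ×
      -- ... and Ehr_ρ*(𝒪(X₁*X₂)) = (1-t) Ehr_ρ₁*(𝒪(X₁)) Ehr_ρ₂*(𝒪(X₂)), at every g ∈ G
      (∀ g m →
        ehrCoeff (size X₁ + size X₂) (joinLeq X₁ X₂) (act (g ⁻¹)) m
          ≡ oneMinusT (ehrCoeff (size X₁) (leq X₁) (act₁ (g ⁻¹))
                       ⊛ ehrCoeff (size X₂) (leq X₂) (act₂ (g ⁻¹))) m)))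
proposition6p10 G _ X₁ X₂ act act-ε act-∙ act-≈ act-mono =
  act₁ , act₂ , (λ g → proj₂ ∘ left g) , (λ g → proj₂ ∘ right g) ,
  λ g → Ehrhart.ehrCoeff-join (act (g ⁻¹)) (act₁ (g ⁻¹)) (act₂ (g ⁻¹))
                             (proj₂ ∘ left (g ⁻¹)) (proj₂ ∘ right (g ⁻¹))
  where
  open Group G using (Carrier; _⁻¹; inverseˡ)
  open Join X₁ X₂

  act-inverse : ∀ g x → act (g ⁻¹) (act g x) ≡ x
  act-inverse g x = trans (sym (act-∙ (g ⁻¹) g x)) (trans (act-≈ _ _ x (inverseˡ g)) (act-ε x))

  act-injective : ∀ g → Injective _≡_ _≡_ (act g)
  act-injective g {x} {y} eq = trans (sym (act-inverse g x)) (trans (cong (act (g ⁻¹)) eq) (act-inverse g y))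

  left : ∀ g i → ∃ λ i′ → act g (i ↑ˡ n₂) ≡ i′ ↑ˡ n₂
  left g = automorphism-↑ˡ (act g) (act-mono g) (act-injective g)

  right : ∀ g j → ∃ λ j′ → act g (n₁ ↑ʳ j) ≡ n₁ ↑ʳ j′
  right g = automorphism-↑ʳ (act g) (act-mono g) (act (g ⁻¹)) (act-inverse g) (left (g ⁻¹))

  act₁ : Carrier → Fin n₁ → Fin n₁
  act₁ g i = proj₁ (left g i)

  act₂ : Carrier → Fin n₂ → Fin n₂
  act₂ g j = proj₁ (right g j)
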